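{- Let $k \in \mathbb{N}_0$ and let $G$ be a perfect graph. Then $G \in F(\omega,k)$ if and only if $G \in F(\chi,k)$. In particular, if all graphs in $F(\omega,k)$ are perfect, then $F(\omega,k)=F(\chi,k)$.
   Context: All graphs are finite and simple. $\Delta(H)$, $\omega(H)$, $\chi(H)$ denote maximum degree, clique number and chromatic number. A graph is perfect if $\omega(H)=\chi(H)$ for every induced subgraph $H$. For $k\in\mathbb{N}_0$: $\varOmega_k$ is the class of graphs $G$ such that every induced subgraph $H$ of $G$ (including $G$) satisfies $\Delta(H)\le\omega(H)+k-1$; $\varUpsilon_k$ is the class of graphs $G$ such that every induced subgraph $H$ of $G$ (including $G$) satisfies $\Delta(H)\le\chi(H)+k-1$. $F(\omega,k)$ (resp. $F(\chi,k)$) is the set of minimal forbidden induced subgraphs of $\varOmega_k$ (resp. $\varUpsilon_k$): graphs not in the class all of whose proper induced subgraphs are in the class (up to isomorphism). -}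

module Defs where

open import Data.Nat using (ℕ; zero; suc; _+_; _∸_; _≤_; _<_; _⊔_)
open import Data.Bool using (Bool; true; false; if_then_else_)
open import Data.Fin using (Fin)
open import Data.List using (List; foldr; map; allFin)
open import Data.Product using (Σ; _×_)
open import Relation.Binary.PropositionalEquality using (_≡_; _≢_)
open import Relation.Nullary using (¬_)
open import Function.Definitions using (Injective)

record Graph : Set where
  field
    n      : ℕ
    adj    : Fin n → Fin n → Bool
    sym    : ∀ u v → adj u v ≡ adj v u
    irrefl : ∀ u → adj u u ≡ false
open Graph public

Adj : (G : Graph) → Fin (n G) → Fin (n G) → Set
Adj G u v = adj G u v ≡ true

degree : (G : Graph) → Fin (n G) → ℕ
degree G v = foldr (λ u acc → (if adj G v u then 1 else 0) + acc) 0 (allFin (n G))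

Δ : Graph → ℕ
Δ G = foldr _⊔_ 0 (map (degree G) (allFin (n G)))

HasClique : Graph → ℕ → Set
HasClique G w = Σ (Fin w → Fin (n G)) λ f → ∀ i j → i ≢ j → Adj G (f i) (f j)

IsCliqueNumber : Graph → ℕ → Set
IsCliqueNumber G w = HasClique G w × (∀ w' → HasClique G w' → w' ≤ w)

Colorable : Graph → ℕ → Set
Colorable G c = Σ (Fin (n G) → Fin c) λ col → ∀ u v → Adj G u v → col u ≢ col v

IsChromaticNumber : Graph → ℕ → Set
IsChromaticNumber G c = Colorable G c × (∀ c' → Colorable G c' → c ≤ c')

InducedSub : Graph → Graph → Set
InducedSub H G = Σ (Fin (n H) → Fin (n G)) λ f →
  Injective _≡_ _≡_ f × (∀ u v → adj H u v ≡ adj G (f u) (f v))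

ProperInducedSub : Graph → Graph → Set
ProperInducedSub H G = InducedSub H G × n H < n G

Perfect : Graph → Set
Perfect G = ∀ H → InducedSub H G → ∀ w c →
  IsCliqueNumber H w → IsChromaticNumber H c → w ≡ c

Ωclass : ℕ → Graph → Set
Ωclass k G = ∀ H → InducedSub H G → ∀ w → IsCliqueNumber H w → Δ H ≤ w + k ∸ 1

Υclass : ℕ → Graph → Set
Υclass k G = ∀ H → InducedSub H G → ∀ c → IsChromaticNumber H c → Δ H ≤ c + k ∸ 1

Fω : ℕ → Graph → Set
Fω k G = ¬ Ωclass k G × (∀ H → ProperInducedSub H G → Ωclass k H)

Fχ : ℕ → Graph → Set
Fχ k G = ¬ Υclass k G × (∀ H → ProperInducedSub H G → Υclass k H)

module Submission where

-- Since ω(H) ≤ χ(H) for every graph H, the condition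
-- Δ(H) ≤ ω(H) + k - 1 implies Δ(H) ≤ χ(H) + k - 1, so Ω_k ⊆ Υ_k; on a
-- perfect graph ω = χ for every induced subgraph, so there Ω_k and Υ_k agree.
-- Minimal forbidden induced subgraphs only look at the graph itself and its
-- induced subgraphs, hence F(ω,k) and F(χ,k) agree on every graph all of whose
-- induced subgraphs lie in Ω_k exactly when they lie in Υ_k; as perfection is
-- hereditary this gives the first part.  For the second part we show by
-- induction on the order that, when every member of F(ω,k) is perfect,
-- Υ_k ⊆ Ω_k for all graphs: a graph of Υ_k outside Ω_k whose proper induced
-- subgraphs all lie in Ω_k would be a perfect member of F(ω,k), contradicting
-- the first inclusion on perfect graphs.
--
-- The graph invariants ω and χ are only given as relations, so their existence
-- is proved in the double-negation monad; this suffices because every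
-- statement about Ω_k and Υ_k is a conjunction of decidable inequalities.

open import Defs
open import Level using (0ℓ)
open import Data.Nat using (ℕ; suc; s≤s; _+_; _∸_; _≤_; _<_; _≤?_)
open import Data.Nat.Properties using (≤-refl; ≤-trans; ≮⇒≥; m∸[m∸n]≡n; ∸-monoʳ-≤; ∸-monoˡ-≤; +-monoˡ-≤; module ≤-Reasoning)
open import Data.Nat.Induction using (<-rec)
open import Data.Product using (_×_; _,_; Σ; ∃; proj₁)
open import Data.Fin.Properties using (_≟_; injective⇒≤)
open import Function.Bundles using (_⇔_; mk⇔; Equivalence)
open import Function.Definitions using (Injective)
open import Effect.Monad using (RawMonad)
open import Relation.Nullary using (¬_; yes; no)
open import Relation.Nullary.Negation using (¬¬-Monad; contradiction)
open import Relation.Nullary.Decidable using (¬¬-excluded-middle; decidable-stable)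
open import Relation.Binary.PropositionalEquality using (_≡_; _≢_; refl; trans; subst)
  renaming (sym to ≡-sym)

open RawMonad (¬¬-Monad {a = 0ℓ}) using (pure; _>>=_; _<$>_)

¬¬_ : Set → Set
¬¬ A = ¬ ¬ A

-- Greatest and least elements of a predicate on ℕ, phrased exactly as the
-- clique number and the chromatic number are phrased in Defs.
Greatest : (ℕ → Set) → Set
Greatest P = Σ ℕ λ w → P w × (∀ w' → P w' → w' ≤ w)

Least : (ℕ → Set) → Set
Least P = Σ ℕ λ c → P c × (∀ c' → P c' → c ≤ c')

¬¬-least : (P : ℕ → Set) → ∀ b → P b → ¬¬ Least P
¬¬-least P = <-rec (λ b → P b → ¬¬ Least P) search
  where
  search : ∀ b → (∀ {c} → c < b → P c → ¬¬ Least P) → P b → ¬¬ Least P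
  search b smaller pb = ¬¬-excluded-middle {A = ∃ λ c → c < b × P c} >>= λ where
    (yes (c , c<b , pc)) → smaller c<b pc
    (no none)            → pure (b , pb , λ c pc → ≮⇒≥ (λ c<b → none (c , c<b , pc)))

-- Classically every inhabited predicate on ℕ bounded by B has a greatest
-- element: it is B ∸ d for the least d with P (B ∸ d).
¬¬-greatest : (P : ℕ → Set) (B : ℕ) → (∀ w → P w → w ≤ B) → ∀ w → P w → ¬¬ Greatest P
¬¬-greatest P B bounded w pw = toGreatest <$> ¬¬-least Q (B ∸ w) (reflect w pw)
  where
  Q : ℕ → Set
  Q d = P (B ∸ d)

  reflect : ∀ w → P w → Q (B ∸ w)
  reflect w pw = subst P (≡-sym (m∸[m∸n]≡n (bounded w pw))) pw

  toGreatest : Least Q → Greatest P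
  toGreatest (d , qd , least) = B ∸ d , qd , λ w' pw' → begin
      w'            ≡⟨ m∸[m∸n]≡n (bounded w' pw') ⟨
      B ∸ (B ∸ w')  ≤⟨ ∸-monoʳ-≤ B (least (B ∸ w') (reflect w' pw')) ⟩
      B ∸ d         ∎
    where open ≤-Reasoning

adjacent⇒distinct : (G : Graph) → ∀ u v → Adj G u v → u ≢ v
adjacent⇒distinct G u .u uv refl with trans (≡-sym uv) (irrefl G u)
... | ()

identityColouring : (G : Graph) → Colorable G (n G)
identityColouring G = (λ u → u) , adjacent⇒distinct G

-- A proper colouring gives the vertices of a clique pairwise distinct colours,
-- hence a w-clique needs at least w colours (the source of ω ≤ χ).
clique≤colours : (G : Graph) → ∀ w c → HasClique G w → Colorable G c → w ≤ c
clique≤colours G w c (f , clique) (col , proper) = injective⇒≤ colour∘f-injective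
  where
  colour∘f-injective : Injective _≡_ _≡_ (λ i → col (f i))
  colour∘f-injective {i} {j} same with i ≟ j
  ... | yes i≡j = i≡j
  ... | no  i≢j = contradiction same (proper (f i) (f j) (clique i j i≢j))

emptyClique : (G : Graph) → HasClique G 0
emptyClique G = (λ ()) , λ ()

¬¬-cliqueNumber : (G : Graph) → ¬¬ (Σ ℕ (IsCliqueNumber G))
¬¬-cliqueNumber G = ¬¬-greatest (HasClique G) (n G)
  (λ w clique → clique≤colours G w (n G) clique (identityColouring G)) 0 (emptyClique G)

¬¬-chromaticNumber : (G : Graph) → ¬¬ (Σ ℕ (IsChromaticNumber G))
¬¬-chromaticNumber G = ¬¬-least (Colorable G) (n G) (identityColouring G)

inducedRefl : (G : Graph) → InducedSub G G
inducedRefl G = (λ u → u) , (λ eq → eq) , λ u v → refl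

inducedTrans : ∀ {A B C} → InducedSub A B → InducedSub B C → InducedSub A C
inducedTrans (g , g-inj , g-adj) (f , f-inj , f-adj) =
  (λ u → f (g u)) , (λ eq → g-inj (f-inj eq)) , λ u v → trans (g-adj u v) (f-adj (g u) (g v))

perfectHereditary : ∀ {H G} → Perfect G → InducedSub H G → Perfect H
perfectHereditary {H} {G} perfect H≤G H' H'≤H = perfect H' (inducedTrans {H'} {H} {G} H'≤H H≤G)

ΥHereditary : ∀ k {H G} → Υclass k G → InducedSub H G → Υclass k H
ΥHereditary k {H} {G} υ H≤G H' H'≤H = υ H' (inducedTrans {H'} {H} {G} H'≤H H≤G)

-- Membership in Ω_k is stable under double negation: it is a family of
-- decidable inequalities.
ΩStable : ∀ k G → ¬¬ (Ωclass k G) → Ωclass k G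
ΩStable k G ¬¬ω H H≤G w ωH = decidable-stable (_ ≤? _) λ violated → ¬¬ω λ ω → violated (ω H H≤G w ωH)

Ω⊆Υ : ∀ k G → Ωclass k G → Υclass k G
Ω⊆Υ k G ω H H≤G c χH@(colouring , _) = decidable-stable (_ ≤? _) (bound <$> ¬¬-cliqueNumber H)
  where
  bound : Σ ℕ (IsCliqueNumber H) → Δ H ≤ c + k ∸ 1
  bound (w , ωH@(clique , _)) = begin
    Δ H        ≤⟨ ω H H≤G w ωH ⟩
    w + k ∸ 1  ≤⟨ ∸-monoˡ-≤ 1 (+-monoˡ-≤ k (clique≤colours H w c clique colouring)) ⟩
    c + k ∸ 1  ∎
    where open ≤-Reasoning

Υ⊆Ω-perfect : ∀ k G → Perfect G → Υclass k G → Ωclass k G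
Υ⊆Ω-perfect k G perfect υ H H≤G w ωH = decidable-stable (_ ≤? _) (bound <$> ¬¬-chromaticNumber H)
  where
  bound : Σ ℕ (IsChromaticNumber H) → Δ H ≤ w + k ∸ 1
  bound (c , χH) rewrite perfect H H≤G w c ωH χH = υ H H≤G c χH

Ω⇔Υ-perfect : ∀ k G → Perfect G → ∀ H → InducedSub H G → Ωclass k H ⇔ Υclass k H
Ω⇔Υ-perfect k G perfect H H≤G =
  mk⇔ (Ω⊆Υ k H) (Υ⊆Ω-perfect k H (perfectHereditary {H} {G} perfect H≤G))

forbidden-congruence : ∀ k G → (∀ H → InducedSub H G → Ωclass k H ⇔ Υclass k H) →
                       Fω k G ⇔ Fχ k G
forbidden-congruence k G agree = mk⇔
  (λ (notΩ , properΩ) → (λ υ → notΩ (from G (inducedRefl G) υ)) ,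
                        λ H H<G → to H (proj₁ H<G) (properΩ H H<G))
  (λ (notΥ , properΥ) → (λ ω → notΥ (to G (inducedRefl G) ω)) ,
                        λ H H<G → from H (proj₁ H<G) (properΥ H H<G))
  where
  to : ∀ H → InducedSub H G → Ωclass k H → Υclass k H
  to H H≤G = Equivalence.to (agree H H≤G)

  from : ∀ H → InducedSub H G → Υclass k H → Ωclass k H
  from H H≤G = Equivalence.from (agree H H≤G)

Υ⊆Ω-forbiddenPerfect : ∀ k → (∀ G → Fω k G → Perfect G) → ∀ G → Υclass k G → Ωclass k G
Υ⊆Ω-forbiddenPerfect k forbiddenPerfect G = bounded (suc (n G)) G ≤-refl
  where
  minimalCase : ∀ G → (∀ H → ProperInducedSub H G → Ωclass k H) → Υclass k G → Ωclass k G
  minimalCase G properΩ υ = ΩStable k G λ notΩ →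
    notΩ (Υ⊆Ω-perfect k G (forbiddenPerfect G (notΩ , properΩ)) υ)

  bounded : ∀ m G → n G < m → Υclass k G → Ωclass k G
  bounded (suc m) G (s≤s G≤m) υ = minimalCase G
    (λ H (H≤G , H<G) → bounded m H (≤-trans H<G G≤m) (ΥHereditary k {H} {G} υ H≤G)) υ

theorem3 : (k : ℕ) →
    ((G : Graph) → Perfect G → (Fω k G ⇔ Fχ k G))
    × (((G : Graph) → Fω k G → Perfect G) → (G : Graph) → (Fω k G ⇔ Fχ k G))
theorem3 k = perfectCase , allForbiddenPerfectCase
  where
  perfectCase : (G : Graph) → Perfect G → Fω k G ⇔ Fχ k G
  perfectCase G perfect = forbidden-congruence k G (Ω⇔Υ-perfect k G perfect)

  allForbiddenPerfectCase : ((G : Graph) → Fω k G → Perfect G) → (G : Graph) → Fω k G ⇔ Fχ k G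
  allForbiddenPerfectCase forbiddenPerfect G = forbidden-congruence k G λ H _ →
    mk⇔ (Ω⊆Υ k H) (Υ⊆Ω-forbiddenPerfect k forbiddenPerfect H)
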